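{- Let $h$ be the map sending each letter of $\{0,1,2\}$ to a set of two words as follows: $h(0)=\{012102120210201021201210,\ 0121021202102012021201210\}$, $h(1)=\{120210201021012102012021,\ 1202102010210120102012021\}$, $h(2)=\{201021012102120210120102,\ 2010210121021201210120102\}$. Then: (1) for any letters $a,b,c\in\{0,1,2\}$, $v\in h(ab)$ and $v'\in h(c)$, the word $v'$ does not occur in $v$ except possibly as a prefix or as a suffix of $v$; (2) for any $a,b\in\{0,1,2\}$ and $v\in h(ab)$, neither $q$ nor $\overline q$ is a factor of $v$; (3) if $a\in\{1,2\}$, $b\in\{0,1,2\}\setminus\{a\}$ and $v\in h(0ab)$, then the word $p\,v$ is square-free and contains exactly one occurrence of $q$ and exactly one occurrence of $\overline q$; (4) if $a\in\{1,2\}$, $b\in\{0,1,2\}\setminus\{a\}$ and $v\in h(ba0)$, then the word $v\,p$ is square-free and contains exactly one occurrence of $q$ and exactly one occurrence of $\overline q$.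
   Context: For a word $w=w_1\ldots w_m$ over $\{0,1,2\}$, $h(w)$ denotes the set of images of $w$, i.e. the set of words $v_1\ldots v_m$ with $v_j\in h(w_j)$ for each $j$. A word $s_1\ldots s_{2m}$ ($m\ge1$) is a square if $s_i=s_{i+m}$ for all $i\le m$; a word is square-free if no factor of it is a square. $\overline w$ is the mirror image of $w$. $q=1202120121021201021$, $\overline{q}=1201021201210212021$, $p=\overline{q}\,0\,q$. -}

module Defs where

open import Data.Nat using (ℕ; zero; suc; _+_)
open import Data.Fin using (Fin; zero; suc)
open import Data.List using (List; []; _∷_; _++_; length; reverse; map; concatMap)
open import Data.Product using (Σ; ∃; _×_; _,_)
open import Relation.Binary.PropositionalEquality using (_≡_; _≢_)
open import Relation.Nullary using (¬_)

Letter : Set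
Letter = Fin 3

Word : Set
Word = List Letter

₀ ₁ ₂ : Letter
₀ = zero
₁ = suc zero
₂ = suc (suc zero)

-- build a word from a list of naturals (digits ≥ 3 are mapped to 2; never used)
digit : ℕ → Letter
digit 0 = ₀
digit 1 = ₁
digit _ = ₂

w : List ℕ → Word
w = map digit

mirror : Word → Word
mirror = reverse

h : Letter → List Word
h zero = w (0 ∷ 1 ∷ 2 ∷ 1 ∷ 0 ∷ 2 ∷ 1 ∷ 2 ∷ 0 ∷ 2 ∷ 1 ∷ 0 ∷ 2 ∷ 0 ∷ 1 ∷ 0 ∷ 2 ∷ 1 ∷ 2 ∷ 0 ∷ 1 ∷ 2 ∷ 1 ∷ 0 ∷ [])
       ∷ w (0 ∷ 1 ∷ 2 ∷ 1 ∷ 0 ∷ 2 ∷ 1 ∷ 2 ∷ 0 ∷ 2 ∷ 1 ∷ 0 ∷ 2 ∷ 0 ∷ 1 ∷ 2 ∷ 0 ∷ 2 ∷ 1 ∷ 2 ∷ 0 ∷ 1 ∷ 2 ∷ 1 ∷ 0 ∷ [])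
       ∷ []
h (suc zero) = w (1 ∷ 2 ∷ 0 ∷ 2 ∷ 1 ∷ 0 ∷ 2 ∷ 0 ∷ 1 ∷ 0 ∷ 2 ∷ 1 ∷ 0 ∷ 1 ∷ 2 ∷ 1 ∷ 0 ∷ 2 ∷ 0 ∷ 1 ∷ 2 ∷ 0 ∷ 2 ∷ 1 ∷ [])
       ∷ w (1 ∷ 2 ∷ 0 ∷ 2 ∷ 1 ∷ 0 ∷ 2 ∷ 0 ∷ 1 ∷ 0 ∷ 2 ∷ 1 ∷ 0 ∷ 1 ∷ 2 ∷ 0 ∷ 1 ∷ 0 ∷ 2 ∷ 0 ∷ 1 ∷ 2 ∷ 0 ∷ 2 ∷ 1 ∷ [])
       ∷ []
h (suc (suc zero)) = w (2 ∷ 0 ∷ 1 ∷ 0 ∷ 2 ∷ 1 ∷ 0 ∷ 1 ∷ 2 ∷ 1 ∷ 0 ∷ 2 ∷ 1 ∷ 2 ∷ 0 ∷ 2 ∷ 1 ∷ 0 ∷ 1 ∷ 2 ∷ 0 ∷ 1 ∷ 0 ∷ 2 ∷ [])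
       ∷ w (2 ∷ 0 ∷ 1 ∷ 0 ∷ 2 ∷ 1 ∷ 0 ∷ 1 ∷ 2 ∷ 1 ∷ 0 ∷ 2 ∷ 1 ∷ 2 ∷ 0 ∷ 1 ∷ 2 ∷ 1 ∷ 0 ∷ 1 ∷ 2 ∷ 0 ∷ 1 ∷ 0 ∷ 2 ∷ [])
       ∷ []

images : Word → List Word
images [] = [] ∷ []
images (a ∷ u) = concatMap (λ x → map (x ++_) (images u)) (h a)

OccursAt : Word → Word → ℕ → Set
OccursAt u v i = Σ Word λ x → Σ Word λ y → (v ≡ x ++ u ++ y) × (length x ≡ i)

Factor : Word → Word → Set
Factor u v = ∃ λ i → OccursAt u v i

ExactlyOnce : Word → Word → Set
ExactlyOnce u v = ∃ λ i → OccursAt u v i × (∀ j → OccursAt u v j → j ≡ i)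

SquareFree : Word → Set
SquareFree v = ∀ x s y → s ≢ [] → v ≢ x ++ s ++ s ++ y

q : Word
q = w (1 ∷ 2 ∷ 0 ∷ 2 ∷ 1 ∷ 2 ∷ 0 ∷ 1 ∷ 2 ∷ 1 ∷ 0 ∷ 2 ∷ 1 ∷ 2 ∷ 0 ∷ 1 ∷ 0 ∷ 2 ∷ 1 ∷ [])

qbar : Word
qbar = mirror q

p : Word
p = qbar ++ ₀ ∷ q

-- Every claim concerns finitely many explicit words: the images of two- and three-letter words
-- under h (at most eight per word, each of length at most 75), p, q and q̄.  So the proof is by
-- reflection.  Occurrences of u in v are the positions i at which drop i v starts with u, and v is
-- square-free when none of its suffixes starts with a square; boolean versions of these tests are
-- proved sound once and for all, and then evaluated on all the relevant words.
module Submission where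

open import Defs
open import Data.Nat using (ℕ; _+_)
open import Data.Fin using (Fin)
open import Data.List using (List; []; _∷_; _++_; length)
open import Data.List.Membership.Propositional using (_∈_)
open import Data.Product using (_×_)
open import Data.Sum using (_⊎_)
open import Relation.Binary.PropositionalEquality using (_≡_; _≢_)
open import Relation.Nullary using (¬_)

open import Data.Bool using (Bool; true; T; _∧_; _∨_)
open import Data.Bool.ListAction using (all)
open import Data.Bool.Properties using (T-∧; T-∨; T-≡)
open import Data.Empty using (⊥-elim)
open import Data.Fin using (_≟_)
open import Data.List using (take; drop; filter; upTo; applyUpTo; tails; allFin; null)
open import Data.List.Membership.Propositional.Properties
  using (∈-filter⁺; ∈-filter⁻; ∈-upTo⁺; ∈-upTo⁻; ∈-applyUpTo⁺; ∈-allFin)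
open import Data.List.Properties using (length-++; length-++-≤ˡ; length-take; take++drop≡id)
open import Data.List.Relation.Binary.Prefix.Heterogeneous using (Prefix)
open import Data.List.Relation.Binary.Prefix.Heterogeneous.Properties using (prefix?)
open import Data.List.Relation.Binary.Prefix.Propositional.Properties using (Prefix-as-∣ˡ; ∣ˡ-as-Prefix)
open import Data.List.Relation.Unary.All using (lookup)
open import Data.List.Relation.Unary.All.Properties using (all⁺)
open import Data.List.Relation.Unary.Any using (here; there)
open import Data.Nat using (suc; _≤_; s≤s; _≡ᵇ_; ⌊_/2⌋)
open import Data.Nat.Properties using (≡ᵇ⇒≡; m≤n⇒m⊓n≡m; ≤-trans; ≤-reflexive; +-monoʳ-≤; ⌊n/2⌋-mono; n≡⌊n+n/2⌋)
open import Data.Product using (_,_)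
open import Data.Sum using (inj₁; inj₂)
open import Function using (Equivalence)
open import Relation.Binary.PropositionalEquality using (refl; sym; trans; cong; subst; subst₂)
open import Relation.Nullary using (Dec)
open import Relation.Nullary.Decidable using (isYes; isNo; toWitness; toWitnessFalse)
open import Relation.Unary using (Decidable)

open Equivalence using (to; from)

T-all⇒ : ∀ {A : Set} {p : A → Bool} {xs x} → T (all p xs) → x ∈ xs → T (p x)
T-all⇒ {p = p} {xs} t x∈xs = lookup (all⁺ p xs t) x∈xs

T-isYes-∨⇒ : ∀ {X : Set} (x? : Dec X) {r : Bool} → T (isYes x? ∨ r) → ¬ X → T r
T-isYes-∨⇒ x? t ¬x with to (T-∨ {isYes x?}) t
... | inj₁ x = ⊥-elim (¬x (toWitness x))
... | inj₂ r = r

∀ᵇ : (Letter → Bool) → Bool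
∀ᵇ p = all p (allFin 3)

∀ᵇ-sound : ∀ p → T (∀ᵇ p) → ∀ a → T (p a)
∀ᵇ-sound p t a = T-all⇒ {p = p} t (∈-allFin a)

∀ᵇ²-sound : ∀ (p : Letter → Letter → Bool) → (∀ᵇ λ a → ∀ᵇ (p a)) ≡ true → ∀ a b → T (p a b)
∀ᵇ²-sound p e a = ∀ᵇ-sound (p a) (∀ᵇ-sound (λ a → ∀ᵇ (p a)) (from T-≡ e) a)

∀ᵇ³-sound : ∀ (p : Letter → Letter → Letter → Bool) →
  (∀ᵇ λ a → ∀ᵇ λ b → ∀ᵇ (p a b)) ≡ true → ∀ a b c → T (p a b c)
∀ᵇ³-sound p e a b = ∀ᵇ-sound (p a b) (∀ᵇ²-sound (λ a b → ∀ᵇ (p a b)) e a b)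

take-length-++ : ∀ (x y : Word) → take (length x) (x ++ y) ≡ x
take-length-++ []      y = refl
take-length-++ (c ∷ x) y = cong (c ∷_) (take-length-++ x y)

drop-length-++ : ∀ (x y : Word) → drop (length x) (x ++ y) ≡ y
drop-length-++ []      y = refl
drop-length-++ (_ ∷ x) y = drop-length-++ x y

∈-tails-++ : ∀ (x y : Word) → y ∈ tails (x ++ y)
∈-tails-++ []      y = here refl
∈-tails-++ (_ ∷ x) y = there (∈-tails-++ x y)

IsPrefix : Word → Word → Set
IsPrefix = Prefix _≡_

prefix-++ : ∀ (u y : Word) → IsPrefix u (u ++ y)
prefix-++ u y = ∣ˡ-as-Prefix record { quotient = y ; equality = refl }

occursAt⇒prefix : ∀ {u v i} → OccursAt u v i → i ≤ length v × IsPrefix u (drop i v)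
occursAt⇒prefix {u} (x , y , refl , refl) =
  length-++-≤ˡ x , subst (IsPrefix u) (sym (drop-length-++ x (u ++ y))) (prefix-++ u y)

prefix⇒occursAt : ∀ {u v i} → i ≤ length v → IsPrefix u (drop i v) → OccursAt u v i
prefix⇒occursAt {u} {v} {i} i≤∣v∣ u⊑v
  with record { quotient = y ; equality = u++y≡ } ← Prefix-as-∣ˡ u⊑v =
  take i v , y , trans (sym (take++drop≡id i v)) (cong (take i v ++_) (sym u++y≡))
  , trans (length-take i v) (m≤n⇒m⊓n≡m i≤∣v∣)

prefixAt? : ∀ u v → Decidable (λ i → IsPrefix u (drop i v))
prefixAt? u v i = prefix? _≟_ u (drop i v)

occurrences : Word → Word → List ℕ
occurrences u v = filter (prefixAt? u v) (upTo (suc (length v)))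

∈-occurrences⁺ : ∀ {u v i} → OccursAt u v i → i ∈ occurrences u v
∈-occurrences⁺ {u} {v} o with i≤∣v∣ , u⊑v ← occursAt⇒prefix o =
  ∈-filter⁺ (prefixAt? u v) (∈-upTo⁺ (s≤s i≤∣v∣)) u⊑v

∈-occurrences⁻ : ∀ {u v i} → i ∈ occurrences u v → OccursAt u v i
∈-occurrences⁻ {u} {v} i∈ with i∈upTo , u⊑v ← ∈-filter⁻ (prefixAt? u v) i∈
  with s≤s i≤∣v∣ ← ∈-upTo⁻ i∈upTo = prefix⇒occursAt i≤∣v∣ u⊑v

occursOnlyAtEndsᵇ : Word → Word → Bool
occursOnlyAtEndsᵇ u v = all (λ i → (i ≡ᵇ 0) ∨ (i + length u ≡ᵇ length v)) (occurrences u v)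

occursOnlyAtEndsᵇ-sound : ∀ {u v} → T (occursOnlyAtEndsᵇ u v) →
  ∀ i → OccursAt u v i → i ≡ 0 ⊎ i + length u ≡ length v
occursOnlyAtEndsᵇ-sound {u} {v} t i o with to T-∨ (T-all⇒ t (∈-occurrences⁺ o))
... | inj₁ i≡ᵇ0    = inj₁ (≡ᵇ⇒≡ i 0 i≡ᵇ0)
... | inj₂ i+∣u∣≡ᵇ = inj₂ (≡ᵇ⇒≡ (i + length u) (length v) i+∣u∣≡ᵇ)

absentᵇ : Word → Word → Bool
absentᵇ u v = null (occurrences u v)

absentᵇ-sound : ∀ {u v} → T (absentᵇ u v) → ¬ Factor u v
absentᵇ-sound {u} {v} t (i , o) with occurrences u v | ∈-occurrences⁺ o
... | []    | ()
... | _ ∷ _ | _ = ⊥-elim t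

onceᵇ : Word → Word → Bool
onceᵇ u v = length (occurrences u v) ≡ᵇ 1

onceᵇ-sound : ∀ {u v} → T (onceᵇ u v) → ExactlyOnce u v
onceᵇ-sound {u} {v} t with occurrences u v in eq | ≡ᵇ⇒≡ (length (occurrences u v)) 1 t
... | i ∷ [] | refl = i , ∈-occurrences⁻ (subst (i ∈_) (sym eq) (here refl)) , unique
  where
  unique : ∀ j → OccursAt u v j → j ≡ i
  unique j o with here j≡i ← subst (j ∈_) eq (∈-occurrences⁺ o) = j≡i

-- A square prefix s s of t has 1 ≤ |s| ≤ ⌊|t|/2⌋.
squarePrefixFreeᵇ : Word → Bool
squarePrefixFreeᵇ t = all (λ l → isNo (prefix? _≟_ (take l t) (drop l t))) (applyUpTo suc ⌊ length t /2⌋)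

squareFreeᵇ : Word → Bool
squareFreeᵇ v = all squarePrefixFreeᵇ (tails v)

squarePrefixFreeᵇ-sound : ∀ s y → T (squarePrefixFreeᵇ (s ++ s ++ y)) → s ≡ []
squarePrefixFreeᵇ-sound []          y _ = refl
squarePrefixFreeᵇ-sound s@(_ ∷ s′) y t =
  ⊥-elim (subst₂ (λ u v → ¬ IsPrefix u v) (take-length-++ s (s ++ y)) (drop-length-++ s (s ++ y))
    (toWitnessFalse (T-all⇒ t (∈-applyUpTo⁺ suc ∣s∣≤half)))
    (prefix-++ s y))
  where
  ∣s∣≤half : length s ≤ ⌊ length (s ++ s ++ y) /2⌋
  ∣s∣≤half = ≤-trans (≤-reflexive (n≡⌊n+n/2⌋ (length s))) (⌊n/2⌋-mono
    (subst (length s + length s ≤_) (sym (length-++ s)) (+-monoʳ-≤ (length s) (length-++-≤ˡ s))))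

squareFreeᵇ-sound : ∀ {v} → T (squareFreeᵇ v) → SquareFree v
squareFreeᵇ-sound t x s y s≢[] refl =
  s≢[] (squarePrefixFreeᵇ-sound s y (T-all⇒ {p = squarePrefixFreeᵇ} t (∈-tails-++ x (s ++ s ++ y))))

squareFreeWithUniqueQᵇ : Word → Bool
squareFreeWithUniqueQᵇ x = squareFreeᵇ x ∧ onceᵇ q x ∧ onceᵇ qbar x

squareFreeWithUniqueQᵇ-sound : ∀ {x} → T (squareFreeWithUniqueQᵇ x) →
  SquareFree x × ExactlyOnce q x × ExactlyOnce qbar x
squareFreeWithUniqueQᵇ-sound {x} t =
  let free , onces = to (T-∧ {squareFreeᵇ x}) t
      once , once′ = to (T-∧ {onceᵇ q x}) onces
  in  squareFreeᵇ-sound free , onceᵇ-sound once , onceᵇ-sound once′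

occursOnlyAtEndsᵇ-images : Letter → Letter → Letter → Bool
occursOnlyAtEndsᵇ-images a b c = all (λ v → all (λ v′ → occursOnlyAtEndsᵇ v′ v) (h c)) (images (a ∷ b ∷ []))

absentᵇ-images : Letter → Letter → Bool
absentᵇ-images a b = all (λ v → absentᵇ q v ∧ absentᵇ qbar v) (images (a ∷ b ∷ []))

squareFreeWithUniqueQᵇ-images : (Word → Word) → (Letter → Letter → Word) → Letter → Letter → Bool
squareFreeWithUniqueQᵇ-images f w a b =
  isYes (a ≟ ₀) ∨ isYes (b ≟ a) ∨ all (λ v → squareFreeWithUniqueQᵇ (f v)) (images (w a b))

prefixedByPᵇ : Letter → Letter → Bool
prefixedByPᵇ = squareFreeWithUniqueQᵇ-images (p ++_) (λ a b → ₀ ∷ a ∷ b ∷ [])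

suffixedByPᵇ : Letter → Letter → Bool
suffixedByPᵇ = squareFreeWithUniqueQᵇ-images (_++ p) (λ a b → b ∷ a ∷ ₀ ∷ [])

occursOnlyAtEndsᵇ-images-sound : (∀ a b c → T (occursOnlyAtEndsᵇ-images a b c)) →
  ∀ (a b c : Letter) (v v′ : Word) → v ∈ images (a ∷ b ∷ []) → v′ ∈ h c →
  ∀ i → OccursAt v′ v i → i ≡ 0 ⊎ i + length v′ ≡ length v
occursOnlyAtEndsᵇ-images-sound t a b c v v′ v∈ v′∈ =
  occursOnlyAtEndsᵇ-sound (T-all⇒ {p = λ v′ → occursOnlyAtEndsᵇ v′ v}
    (T-all⇒ {p = λ v → all (λ v′ → occursOnlyAtEndsᵇ v′ v) (h c)} (t a b c) v∈) v′∈)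

absentᵇ-images-sound : (∀ a b → T (absentᵇ-images a b)) →
  ∀ (a b : Letter) (v : Word) → v ∈ images (a ∷ b ∷ []) → ¬ Factor q v × ¬ Factor qbar v
absentᵇ-images-sound t a b v v∈ =
  let absent-q , absent-qbar = to T-∧ (T-all⇒ {p = λ v → absentᵇ q v ∧ absentᵇ qbar v} (t a b) v∈)
  in  absentᵇ-sound absent-q , absentᵇ-sound absent-qbar

squareFreeWithUniqueQᵇ-images-sound : ∀ f w → (∀ a b → T (squareFreeWithUniqueQᵇ-images f w a b)) →
  ∀ (a b : Letter) (v : Word) → a ≢ ₀ → b ≢ a → v ∈ images (w a b) →
  SquareFree (f v) × ExactlyOnce q (f v) × ExactlyOnce qbar (f v)
squareFreeWithUniqueQᵇ-images-sound f w t a b v a≢₀ b≢a v∈ =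
  squareFreeWithUniqueQᵇ-sound (T-all⇒ {p = λ v → squareFreeWithUniqueQᵇ (f v)}
    (T-isYes-∨⇒ (b ≟ a) (T-isYes-∨⇒ (a ≟ ₀) (t a b) a≢₀) b≢a) v∈)

-- Stated with _≡ true and proved by refl: checking them as T _ by tt makes Agda evaluate
-- with a much slower strategy.  Likewise the predicates are named, so that these types match
-- the ones expected below syntactically, without being evaluated again.

occursOnlyAtEnds-verified : (∀ᵇ λ a → ∀ᵇ λ b → ∀ᵇ (occursOnlyAtEndsᵇ-images a b)) ≡ true
occursOnlyAtEnds-verified = refl

absent-verified : (∀ᵇ λ a → ∀ᵇ (absentᵇ-images a)) ≡ true
absent-verified = refl

prefixedByP-verified : (∀ᵇ λ a → ∀ᵇ (prefixedByPᵇ a)) ≡ true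
prefixedByP-verified = refl

suffixedByP-verified : (∀ᵇ λ a → ∀ᵇ (suffixedByPᵇ a)) ≡ true
suffixedByP-verified = refl

lemma4 :
    (∀ (a b c : Letter) (v v′ : Word) → v ∈ images (a ∷ b ∷ []) → v′ ∈ h c →
       ∀ i → OccursAt v′ v i → (i ≡ 0) ⊎ (i + length v′ ≡ length v))
    × (∀ (a b : Letter) (v : Word) → v ∈ images (a ∷ b ∷ []) →
       ¬ Factor q v × ¬ Factor qbar v)
    × (∀ (a b : Letter) (v : Word) → a ≢ ₀ → b ≢ a → v ∈ images (₀ ∷ a ∷ b ∷ []) →
       SquareFree (p ++ v) × ExactlyOnce q (p ++ v) × ExactlyOnce qbar (p ++ v))
    × (∀ (a b : Letter) (v : Word) → a ≢ ₀ → b ≢ a → v ∈ images (b ∷ a ∷ ₀ ∷ []) →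
       SquareFree (v ++ p) × ExactlyOnce q (v ++ p) × ExactlyOnce qbar (v ++ p))
lemma4 =
    occursOnlyAtEndsᵇ-images-sound (∀ᵇ³-sound occursOnlyAtEndsᵇ-images occursOnlyAtEnds-verified)
  , absentᵇ-images-sound (∀ᵇ²-sound absentᵇ-images absent-verified)
  , squareFreeWithUniqueQᵇ-images-sound (p ++_) (λ a b → ₀ ∷ a ∷ b ∷ [])
      (∀ᵇ²-sound prefixedByPᵇ prefixedByP-verified)
  , squareFreeWithUniqueQᵇ-images-sound (_++ p) (λ a b → b ∷ a ∷ ₀ ∷ [])
      (∀ᵇ²-sound suffixedByPᵇ suffixedByP-verified)
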